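{- Let $G=(V,E)$ be a finite weakly connected directed graph without loops whose edge set is partitioned as $E=E_1\cup\cdots\cup E_p$ into pairwise disjoint classes. Fix $i$ and let $G_i=(V,E\cup R_i)$ be the projection of $G$ along direction $i$, where $R_i=\{(u,v):(v,u)\in E\setminus E_i\}$. Let $G^i_{co}=(V^i_{co},E^i_{co})$ be the condensation of $G_i$. Then there is a set $\bar E_i\subseteq E_i$ whose removal implies a maximal PFD of $G$ along direction $i$ and whose implied CCG is exactly $G^i_{co}$ (its vertices, as vertex sets, are the strongly connected components of $G_i$, and its edges are those of $G^i_{co}$).
   Context: Component connectivity graph (CCG) implied by the removal of a set $F\subseteq E_i$: the simple directed graph whose vertices are the weakly connected components (identified with their vertex sets) of $(V,E\setminus F)$, with an edge $(C,C')$ if and only if $C\ne C'$ and there is an edge $(v,u)\in F$ with $v\in C$, $u\in C'$. The removal of $F$ implies a PFD (physically feasible decomposition) along direction $i$ if this CCG is a directed acyclic graph. The removal of $F\subseteq E_i$ implies a maximal PFD along direction $i$ if it implies a PFD and every set $F'$ with $F\subseteq F'\subseteq E_i$ whose removal implies a PFD implies the same CCG as $F$. The condensation of a directed graph has the strongly connected components as vertices and an edge $(C,C')$, $C\neq C'$, whenever some edge of the graph goes from a vertex of $C$ to a vertex of $C'$. -}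

module Defs where

open import Data.Nat using (ℕ)
open import Data.Fin using (Fin)
open import Data.Bool using (Bool; true; false)
open import Data.Maybe using (Maybe; just; nothing)
open import Data.Product using (Σ; ∃; _×_; _,_)
open import Data.Sum using (_⊎_)
open import Relation.Nullary using (¬_)
open import Relation.Binary.PropositionalEquality using (_≡_)
open import Relation.Binary.Construct.Closure.ReflexiveTransitive using (Star)
open import Relation.Binary.Construct.Closure.Transitive using (TransClosure)
open import Function.Bundles using (_⇔_)

-- A finite directed graph on vertex set V = Fin n whose edge set is
-- partitioned into p classes E_1,...,E_p is encoded by a labelling
--   E u v = nothing   : (u,v) is not an edge
--   E u v = just j    : (u,v) is an edge, belonging to class E_j.
LabGraph : ℕ → ℕ → Set
LabGraph n p = Fin n → Fin n → Maybe (Fin p)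

module _ {n p : ℕ} (E : LabGraph n p) where

  IsEdge : Fin n → Fin n → Set
  IsEdge u v = ∃ λ j → E u v ≡ just j

  InClass : Fin p → Fin n → Fin n → Set
  InClass i u v = E u v ≡ just i

  Loopless : Set
  Loopless = ∀ v → E v v ≡ nothing

  WeaklyConnected : Set
  WeaklyConnected = ∀ a b → Star (λ u v → IsEdge u v ⊎ IsEdge v u) a b

  EdgeSet : Set
  EdgeSet = Fin n → Fin n → Bool

  SubsetOfClass : Fin p → EdgeSet → Set
  SubsetOfClass i F = ∀ u v → F u v ≡ true → InClass i u v

  _⊆F_ : EdgeSet → EdgeSet → Set
  F ⊆F F' = ∀ u v → F u v ≡ true → F' u v ≡ true

  RemEdge : EdgeSet → Fin n → Fin n → Set
  RemEdge F u v = IsEdge u v × F u v ≡ false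

  SameComp : EdgeSet → Fin n → Fin n → Set
  SameComp F = Star (λ u v → RemEdge F u v ⊎ RemEdge F v u)

  -- CCG edge between the component of a and the component of b
  -- (components are represented by any of their vertices)
  CCGEdge : EdgeSet → Fin n → Fin n → Set
  CCGEdge F a b = Σ (Fin n) λ v → Σ (Fin n) λ u →
    F v u ≡ true × SameComp F a v × SameComp F b u × ¬ SameComp F a b

  ImpliesPFD : EdgeSet → Set
  ImpliesPFD F = ∀ a b → TransClosure (CCGEdge F) a b → ¬ SameComp F a b

  SameCCG : EdgeSet → EdgeSet → Set
  SameCCG F F' = (∀ a b → SameComp F a b ⇔ SameComp F' a b)
               × (∀ a b → CCGEdge F a b ⇔ CCGEdge F' a b)

  ImpliesMaximalPFD : Fin p → EdgeSet → Set
  ImpliesMaximalPFD i F = ImpliesPFD F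
    × (∀ F' → F ⊆F F' → SubsetOfClass i F' → ImpliesPFD F' → SameCCG F F')

  ProjEdge : Fin p → Fin n → Fin n → Set
  ProjEdge i u v = IsEdge u v ⊎ (IsEdge v u × ¬ InClass i v u)

  SameSCC : Fin p → Fin n → Fin n → Set
  SameSCC i a b = Star (ProjEdge i) a b × Star (ProjEdge i) b a

  CondEdge : Fin p → Fin n → Fin n → Set
  CondEdge i a b = Σ (Fin n) λ v → Σ (Fin n) λ u →
    ProjEdge i v u × SameSCC i a v × SameSCC i b u × ¬ SameSCC i a b

module Submission where

-- Let ~ be "same strongly connected component of the
-- projection G_i" and take for F̄ the E_i-edges joining two different
-- ~-classes.  Every edge of E outside F̄ stays inside a ~-class (an edge
-- outside E_i is traversable both ways in G_i), and conversely every G_i-edge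
-- inside a ~-class comes from an edge of E \ F̄; hence the weak components of
-- (V, E \ F̄) are exactly the SCCs of G_i, and the CCG of F̄ is exactly the
-- condensation of G_i, which is acyclic.  For maximality, let F̄ ⊆ F' ⊆ E_i
-- imply a PFD.  Since F' ⊆ E_i, every G_i-path either stays in one
-- F'-component or induces a path in the CCG of F'; acyclicity of that CCG
-- forces the two ends of any G_i-cycle into one F'-component, so F' has the
-- same components (and then the same CCG) as F̄.

open import Defs
open import Data.Nat using (ℕ; zero; suc; _<_; _≤_)
open import Data.Nat.Properties
  using (m<1+n⇒m<n∨m≡n; m<n⇒m<1+n; n<1+n; ≤-refl; <⇒≤)
open import Data.Fin using (Fin; toℕ; fromℕ<; _≟_)
open import Data.Fin.Properties using (toℕ-fromℕ<; toℕ-injective; toℕ<n)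
open import Data.Bool using (true; false)
import Data.Bool.Properties as Bool
open import Data.Maybe using (just; nothing)
open import Data.Maybe.Properties using (just-injective)
open import Data.Product using (Σ; _×_; _,_; proj₁; proj₂)
open import Data.Sum using (_⊎_; inj₁; inj₂)
open import Data.Empty using (⊥-elim)
open import Function using (_∘_)
open import Function.Bundles using (_⇔_; mk⇔)
open import Relation.Nullary using (¬_; Dec; yes; no; does; contradiction)
open import Relation.Nullary.Decidable
  using (_⊎-dec_; _×-dec_; ¬?; map′; dec-true; dec-false; decidable-stable)
open import Relation.Binary.PropositionalEquality using (_≡_; refl; sym; trans; cong)
open import Relation.Binary.Construct.Closure.ReflexiveTransitive
  using (Star; ε; _◅_; _◅◅_; fold; reverse)
import Relation.Binary.Construct.Closure.ReflexiveTransitive as Star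
open import Relation.Binary.Construct.Closure.Transitive using (TransClosure; [_]; _∷_; _++_)

-- Reachability in a decidable relation on a finite set is decidable, by the
-- Floyd–Warshall induction on the set of allowed intermediate vertices.
module FiniteReachability {n : ℕ} (R : Fin n → Fin n → Set)
                          (R? : ∀ x y → Dec (R x y)) where

  data Via (k : ℕ) : Fin n → Fin n → Set where
    edge : ∀ {a b} → R a b → Via k a b
    via  : ∀ {a b c} → Via k a c → toℕ c < k → Via k c b → Via k a b

  Via⇒Star : ∀ {k a b} → Via k a b → Star R a b
  Via⇒Star (edge r)    = r ◅ ε
  Via⇒Star (via p _ q) = Via⇒Star p ◅◅ Via⇒Star q

  -- Every vertex has index < n, so Via n is unrestricted reachability in ≥ 1 step.
  Star⇒Via : ∀ {a b} → Star R a b → a ≡ b ⊎ Via n a b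
  Star⇒Via ε = inj₁ refl
  Star⇒Via (r ◅ rs) with Star⇒Via rs
  ... | inj₁ refl = inj₂ (edge r)
  ... | inj₂ p    = inj₂ (via (edge r) (toℕ<n _) p)

  weaken : ∀ {k a b} → Via k a b → Via (suc k) a b
  weaken (edge r)      = edge r
  weaken (via p c<k q) = via (weaken p) (m<n⇒m<1+n c<k) (weaken q)

  -- Allowing the new intermediate vertex c (of index k): a path either
  -- avoids c, or splits at c into two paths avoiding it.
  Split : ℕ → Fin n → Fin n → Fin n → Set
  Split k c a b = Via k a b ⊎ (Via k a c × Via k c b)

  split : ∀ {k a b} (c : Fin n) → toℕ c ≡ k → Via (suc k) a b → Split k c a b
  split c c≡k (edge r) = inj₁ (edge r)
  split {k} c c≡k (via {c = d} p d<1+k q) with m<1+n⇒m<n∨m≡n d<1+k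
  ... | inj₁ d<k = glue (split c c≡k p) (split c c≡k q)
    where
      glue : ∀ {a b} → Split k c a d → Split k c d b → Split k c a b
      glue (inj₁ p')         (inj₁ q')         = inj₁ (via p' d<k q')
      glue (inj₁ p')         (inj₂ (q₁ , q₂))  = inj₂ (via p' d<k q₁ , q₂)
      glue (inj₂ (p₁ , p₂))  (inj₁ q')         = inj₂ (p₁ , via p₂ d<k q')
      glue (inj₂ (p₁ , _))   (inj₂ (_ , q₂))   = inj₂ (p₁ , q₂)
  ... | inj₂ d≡k with toℕ-injective (trans d≡k (sym c≡k))
  ...   | refl = inj₂ (toC (split c c≡k p) , fromC (split c c≡k q))
    where
      toC : ∀ {a} → Split k c a c → Via k a c
      toC (inj₁ p')       = p'
      toC (inj₂ (p' , _)) = p'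
      fromC : ∀ {b} → Split k c c b → Via k c b
      fromC (inj₁ q')       = q'
      fromC (inj₂ (_ , q')) = q'

  unsplit : ∀ {k a b} (c : Fin n) → toℕ c ≡ k → Split k c a b → Via (suc k) a b
  unsplit c c≡k (inj₁ p)       = weaken p
  unsplit c refl (inj₂ (p , q)) = via (weaken p) (n<1+n _) (weaken q)

  via? : ∀ k → k ≤ n → ∀ a b → Dec (Via k a b)
  via? zero _ a b = map′ edge fromEdge (R? a b)
    where
      fromEdge : Via zero a b → R a b
      fromEdge (edge r) = r
  via? (suc k) k<n a b =
    map′ (unsplit c c≡k) (split c c≡k)
         (via? k k≤n a b ⊎-dec (via? k k≤n a c ×-dec via? k k≤n c b))
    where
      c = fromℕ< k<n
      c≡k = toℕ-fromℕ< k<n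
      k≤n = <⇒≤ k<n

  star? : ∀ a b → Dec (Star R a b)
  star? a b with a ≟ b
  ... | yes refl = yes ε
  ... | no a≢b   = map′ Via⇒Star fromStar (via? n ≤-refl a b)
    where
      fromStar : Star R a b → Via n a b
      fromStar s with Star⇒Via s
      ... | inj₁ a≡b = ⊥-elim (a≢b a≡b)
      ... | inj₂ p   = p

witness : {A : Set} (A? : Dec A) → does A? ≡ true → A
witness (yes a) _  = a
witness (no _)  ()

module Projection {n p : ℕ} (E : LabGraph n p) (i : Fin p) where

  Reach : Fin n → Fin n → Set
  Reach = Star (ProjEdge E i)

  isEdge? : ∀ u v → Dec (IsEdge E u v)
  isEdge? u v with E u v
  ... | just j  = yes (j , refl)
  ... | nothing = no λ ()

  inClass? : ∀ u v → Dec (InClass E i u v)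
  inClass? u v with E u v
  ... | just j  = map′ (cong just) just-injective (j ≟ i)
  ... | nothing = no λ ()

  projEdge? : ∀ u v → Dec (ProjEdge E i u v)
  projEdge? u v = isEdge? u v ⊎-dec (isEdge? v u ×-dec ¬? (inClass? v u))

  sameSCC? : ∀ u v → Dec (SameSCC E i u v)
  sameSCC? u v = star? u v ×-dec star? v u
    where open FiniteReachability (ProjEdge E i) projEdge?

  scc-refl : ∀ {a} → SameSCC E i a a
  scc-refl = ε , ε

  scc-sym : ∀ {a b} → SameSCC E i a b → SameSCC E i b a
  scc-sym (ab , ba) = ba , ab

  scc-trans : ∀ {a b c} → SameSCC E i a b → SameSCC E i b c → SameSCC E i a c
  scc-trans (ab , ba) (bc , cb) = ab ◅◅ bc , cb ◅◅ ba

  two-way : ∀ {u v} → IsEdge E u v → ¬ InClass E i u v → SameSCC E i u v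
  two-way e ¬c = inj₁ e ◅ ε , inj₂ (e , ¬c) ◅ ε

  crossing-in-class : ∀ {u v} → ProjEdge E i u v → ¬ SameSCC E i u v → InClass E i u v
  crossing-in-class {u} {v} (inj₁ e) ¬s =
    decidable-stable (inClass? u v) (λ ¬c → ¬s (two-way e ¬c))
  crossing-in-class (inj₂ (e , ¬c)) ¬s = ⊥-elim (¬s (scc-sym (two-way e ¬c)))

  Crossing : Fin n → Fin n → Set
  Crossing u v = InClass E i u v × ¬ SameSCC E i u v

  crossing? : ∀ u v → Dec (Crossing u v)
  crossing? u v = inClass? u v ×-dec ¬? (sameSCC? u v)

  F̄ : EdgeSet E
  F̄ u v = does (crossing? u v)

  F̄-sound : ∀ {u v} → F̄ u v ≡ true → Crossing u v
  F̄-sound {u} {v} = witness (crossing? u v)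

  F̄-complete : ∀ {u v} → Crossing u v → F̄ u v ≡ true
  F̄-complete {u} {v} = dec-true (crossing? u v)

  F̄-within : ∀ {u v} → SameSCC E i u v → F̄ u v ≡ false
  F̄-within {u} {v} s = dec-false (crossing? u v) (λ c → proj₂ c s)

  F̄-false : ∀ {u v} → F̄ u v ≡ false → ¬ Crossing u v
  F̄-false f c = contradiction (trans (sym (F̄-complete c)) f) λ ()

  F̄⊆Eᵢ : SubsetOfClass E i F̄
  F̄⊆Eᵢ u v = proj₁ ∘ F̄-sound

  kept⇒scc : ∀ {u v} → RemEdge E F̄ u v → SameSCC E i u v
  kept⇒scc {u} {v} (e , f) = decidable-stable (sameSCC? u v) λ u≁v →
    F̄-false f (decidable-stable (inClass? u v) (λ ¬c → u≁v (two-way e ¬c)) , u≁v)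

  comp⇒scc : ∀ {a b} → SameComp E F̄ a b → SameSCC E i a b
  comp⇒scc = fold (SameSCC E i) (λ step s → scc-trans (undirected step) s) scc-refl
    where
      undirected : ∀ {u v} → RemEdge E F̄ u v ⊎ RemEdge E F̄ v u → SameSCC E i u v
      undirected (inj₁ r) = kept⇒scc r
      undirected (inj₂ r) = scc-sym (kept⇒scc r)

  within⇒comp : ∀ {u v} → ProjEdge E i u v → SameSCC E i u v → SameComp E F̄ u v
  within⇒comp (inj₁ e)       s = inj₁ (e , F̄-within s) ◅ ε
  within⇒comp (inj₂ (e , _)) s = inj₂ (e , F̄-within (scc-sym s)) ◅ ε

  -- On a G_i-path u ⇝ b that is part of a closed walk through a, every edge
  -- lies inside one SCC, so the whole path stays in one component.
  cycle⇒comp : ∀ {a u b} → Reach a u → Reach u b → Reach b a → SameComp E F̄ u b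
  cycle⇒comp a⇝u ε b⇝a = ε
  cycle⇒comp a⇝u (e ◅ v⇝b) b⇝a =
    within⇒comp e (e ◅ ε , v⇝b ◅◅ b⇝a ◅◅ a⇝u)
      ◅◅ cycle⇒comp (a⇝u ◅◅ e ◅ ε) v⇝b b⇝a

  scc⇒comp : ∀ {a b} → SameSCC E i a b → SameComp E F̄ a b
  scc⇒comp (a⇝b , b⇝a) = cycle⇒comp ε a⇝b b⇝a

  ccg⇒cond : ∀ {a b} → CCGEdge E F̄ a b → CondEdge E i a b
  ccg⇒cond (v , u , t , a~v , b~u , a≁b) =
    v , u , inj₁ (i , proj₁ (F̄-sound t)) ,
    comp⇒scc a~v , comp⇒scc b~u , a≁b ∘ scc⇒comp

  cond⇒ccg : ∀ {a b} → CondEdge E i a b → CCGEdge E F̄ a b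
  cond⇒ccg (v , u , e , a~v , b~u , a≁b) =
    v , u , F̄-complete (crossing-in-class e v≁u , v≁u) ,
    scc⇒comp a~v , scc⇒comp b~u , a≁b ∘ comp⇒scc
    where
      v≁u : ¬ SameSCC E i v u
      v≁u v~u = a≁b (scc-trans a~v (scc-trans v~u (scc-sym b~u)))

  forward-acyclic : {C : Fin n → Fin n → Set} →
    (∀ {a b} → C a b → Reach a b × ¬ SameSCC E i a b) →
    ∀ {a b} → TransClosure C a b → ¬ SameSCC E i a b
  forward-acyclic fwd [ c ] = proj₂ (fwd c)
  forward-acyclic fwd (c ∷ cs) (_ , b⇝a) =
    proj₂ (fwd c) (proj₁ (fwd c) , reach cs ◅◅ b⇝a)
    where
      reach : ∀ {x y} → TransClosure _ x y → Reach x y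
      reach [ c ]    = proj₁ (fwd c)
      reach (c ∷ cs) = proj₁ (fwd c) ◅◅ reach cs

  cond-forward : ∀ {a b} → CondEdge E i a b → Reach a b × ¬ SameSCC E i a b
  cond-forward (v , u , e , a~v , b~u , a≁b) = proj₁ a~v ◅◅ e ◅ proj₂ b~u , a≁b

  -- Removing F̄ implies a PFD, since its CCG embeds in the condensation.
  F̄-pfd : ImpliesPFD E F̄
  F̄-pfd a b path a~b =
    forward-acyclic (cond-forward ∘ ccg⇒cond) path (comp⇒scc a~b)

  module WithinClass (F' : EdgeSet E) (F'⊆Eᵢ : SubsetOfClass E i F') where

    Comp' : Fin n → Fin n → Set
    Comp' = SameComp E F'

    Link' : Fin n → Fin n → Set
    Link' u v = RemEdge E F' u v ⊎ RemEdge E F' v u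

    comp'? : ∀ u v → Dec (Comp' u v)
    comp'? = star?
      where
        link'? : ∀ u v → Dec (Link' u v)
        link'? u v = (isEdge? u v ×-dec (F' u v Bool.≟ false))
                ⊎-dec (isEdge? v u ×-dec (F' v u Bool.≟ false))
        open FiniteReachability Link' link'?

    comp'-sym : ∀ {a b} → Comp' a b → Comp' b a
    comp'-sym = reverse flip-link
      where
        flip-link : ∀ {u v} → Link' u v → Link' v u
        flip-link (inj₁ r) = inj₂ r
        flip-link (inj₂ r) = inj₁ r

    CCG' : Fin n → Fin n → Set
    CCG' = CCGEdge E F'

    ccg'-resp-left : ∀ {a a' b} → Comp' a a' → CCG' a b → CCG' a' b
    ccg'-resp-left a~a' (v , u , t , a~v , b~u , a≁b) =
      v , u , t , comp'-sym a~a' ◅◅ a~v , b~u , λ a'~b → a≁b (a~a' ◅◅ a'~b)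

    ccg'-resp-right : ∀ {a b b'} → CCG' a b → Comp' b b' → CCG' a b'
    ccg'-resp-right (v , u , t , a~v , b~u , a≁b) b~b' =
      v , u , t , a~v , comp'-sym b~b' ◅◅ b~u ,
      λ a~b' → a≁b (a~b' ◅◅ comp'-sym b~b')

    -- A G_i-edge lies in one F'-component or is a CCG edge: reversed edges
    -- come from E \ E_i and are therefore never removed.
    step : ∀ {x y} → ProjEdge E i x y → Comp' x y ⊎ CCG' x y
    step {x} {y} (inj₁ e) with F' x y in F'xy | comp'? x y
    ... | false | _       = inj₁ (inj₁ (e , F'xy) ◅ ε)
    ... | true  | yes x~y = inj₁ x~y
    ... | true  | no x≁y  = inj₂ (x , y , F'xy , ε , ε , x≁y)
    step {x} {y} (inj₂ (e , ¬c)) with F' y x in F'yx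
    ... | false = inj₁ (inj₂ (e , F'yx) ◅ ε)
    ... | true  = ⊥-elim (¬c (F'⊆Eᵢ y x F'yx))

    walk : ∀ {x y} → Reach x y → Comp' x y ⊎ TransClosure CCG' x y
    walk ε = inj₁ ε
    walk (e ◅ rest) with step e | walk rest
    ... | inj₁ s | inj₁ s'       = inj₁ (s ◅◅ s')
    ... | inj₁ s | inj₂ [ c ]    = inj₂ [ ccg'-resp-left (comp'-sym s) c ]
    ... | inj₁ s | inj₂ (c ∷ cs) = inj₂ (ccg'-resp-left (comp'-sym s) c ∷ cs)
    ... | inj₂ c | inj₁ s'       = inj₂ [ ccg'-resp-right c s' ]
    ... | inj₂ c | inj₂ cs       = inj₂ (c ∷ cs)

    -- With an acyclic CCG, both directions of a G_i-cycle cannot leave the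
    -- component, so every SCC lies in one F'-component.
    scc⇒comp' : ImpliesPFD E F' → ∀ {a b} → SameSCC E i a b → Comp' a b
    scc⇒comp' pfd {a} {b} (a⇝b , b⇝a) with walk a⇝b | walk b⇝a
    ... | inj₁ a~b | _        = a~b
    ... | inj₂ cs  | inj₁ b~a = ⊥-elim (pfd a b cs (comp'-sym b~a))
    ... | inj₂ cs  | inj₂ ds  = ⊥-elim (pfd a a (cs ++ ds) ε)

  F̄-maximal : ∀ F' → _⊆F_ E F̄ F' → SubsetOfClass E i F' → ImpliesPFD E F' →
    SameCCG E F̄ F'
  F̄-maximal F' F̄⊆F' F'⊆Eᵢ pfd' =
    (λ a b → mk⇔ comp⇒comp' comp'⇒comp) , (λ a b → mk⇔ ccg⇒ccg' ccg'⇒ccg)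
    where
      open WithinClass F' F'⊆Eᵢ

      -- Removing more edges only splits components.
      comp'⇒comp : ∀ {a b} → Comp' a b → SameComp E F̄ a b
      comp'⇒comp = Star.map λ
        { (inj₁ (e , f)) → inj₁ (e , kept f)
        ; (inj₂ (e , f)) → inj₂ (e , kept f) }
        where
          kept : ∀ {u v} → F' u v ≡ false → F̄ u v ≡ false
          kept {u} {v} f =
            Bool.¬-not λ t → contradiction (trans (sym (F̄⊆F' u v t)) f) λ ()

      comp⇒comp' : ∀ {a b} → SameComp E F̄ a b → Comp' a b
      comp⇒comp' = scc⇒comp' pfd' ∘ comp⇒scc

      ccg⇒ccg' : ∀ {a b} → CCGEdge E F̄ a b → CCG' a b
      ccg⇒ccg' (v , u , t , a~v , b~u , a≁b) =
        v , u , F̄⊆F' v u t , comp⇒comp' a~v , comp⇒comp' b~u , a≁b ∘ comp'⇒comp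

      ccg'⇒ccg : ∀ {a b} → CCG' a b → CCGEdge E F̄ a b
      ccg'⇒ccg (v , u , t , a~v , b~u , a≁b) =
        v , u , F̄-complete (F'⊆Eᵢ v u t , v≁u) ,
        comp'⇒comp a~v , comp'⇒comp b~u , a≁b ∘ comp⇒comp'
        where
          v≁u : ¬ SameSCC E i v u
          v≁u v~u = a≁b (a~v ◅◅ scc⇒comp' pfd' v~u ◅◅ comp'-sym b~u)

theorem4 : (n p : ℕ) (E : LabGraph n p) → Loopless E → WeaklyConnected E →
    (i : Fin p) →
    Σ (EdgeSet E) λ F → SubsetOfClass E i F × ImpliesMaximalPFD E i F
      × (∀ a b → SameComp E F a b ⇔ SameSCC E i a b)
      × (∀ a b → CCGEdge E F a b ⇔ CondEdge E i a b)
theorem4 n p E _ _ i =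
  F̄ , F̄⊆Eᵢ , (F̄-pfd , F̄-maximal) ,
  (λ a b → mk⇔ comp⇒scc scc⇒comp) , (λ a b → mk⇔ ccg⇒cond cond⇒ccg)
  where open Projection E i
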